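{- (1) Let $k\geq 1$ and let $(C_1,C_2)$ be the type A partition of $\mathbb{Z}_2^{3k}$. Define $f$ on $\mathbb{Z}_2^{3k}$ by $f(x)=3k$ if $x\in C_1$ and $f(x)=-k$ if $x\in C_2$. Then $f$ is a $4k$-eigenfunction of $H(3k,2)$. (2) Let $n\ge 1$, $q\geq 2$, $C_1=\Gamma_0^{n,q}$ and $C_2=\Gamma_1^{n,q}\cup\cdots\cup\Gamma_{q-1}^{n,q}$. Define $f$ on $\mathbb{Z}_q^n$ by $f(x)=n(q-1)$ if $x\in C_1$ and $f(x)=-n$ if $x\in C_2$. Then $f$ is a $qn$-eigenfunction of $H(n,q)$.
   Context: $H(n,q)$ is the graph on $\mathbb{Z}_q^n$ in which two vertices are adjacent iff they differ in exactly one coordinate. For a graph $G$ with vertex set $V$ and real $\lambda$, a $\lambda$-eigenfunction of $G$ is a function $f:V\to\mathbb{R}$, $f\not\equiv 0$, with $\lambda f(x)=\sum_{y\in N(x)}(f(x)-f(y))$ for all $x\in V$, $N(x)$ being the neighbourhood of $x$. The type A partition $(C_1,C_2)$ of $\mathbb{Z}_2^{3k}$: $x\in C_1$ iff $\bigl(\sum_{i=1}^{k}x_i,\sum_{i=k+1}^{2k}x_i,\sum_{i=2k+1}^{3k}x_i\bigr)$ (mod 2) lies in $\{(0,0,0),(1,1,1)\}$, and $C_2$ is the complement. For $a\in\mathbb{Z}_q$, $\Gamma_a^{n,q}=\{x\in\mathbb{Z}_q^n:x_1+\cdots+x_n=a\}$ (sum in $\mathbb{Z}_q$). -}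

module Defs where

open import Data.Nat as ℕ using (ℕ; zero; suc; NonZero; _%_)
open import Data.Fin as Fin using (Fin; toℕ; _↑ˡ_; _↑ʳ_)
open import Data.Integer as ℤ using (ℤ)
open import Data.List using (List; []; _∷_; map; concatMap; filter; allFin)
open import Data.Vec.Functional using (Vector; updateAt)
open import Data.Product using (_×_; _,_)
open import Relation.Nullary using (¬_; Dec; yes; no)
open import Relation.Nullary.Decidable using (¬?)
open import Relation.Binary.PropositionalEquality using (_≡_)

Vertex : ℕ → ℕ → Set
Vertex n q = Vector (Fin q) n

set : ∀ {n q} → Vertex n q → Fin n → Fin q → Vertex n q
set x i a = updateAt x i (λ _ → a)

-- The neighbourhood N(x) in H(n,q), as a list without repetitions:
-- the vertices differing from x in exactly one coordinate are exactly
-- x[i := a] with i a coordinate and a ≠ x i, each obtained once.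
neighbours : ∀ {n q} → Vertex n q → List (Vertex n q)
neighbours {n} {q} x =
  concatMap (λ i → map (set x i) (filter (λ a → ¬? (a Fin.≟ x i)) (allFin q)))
            (allFin n)

sumℤ : List ℤ → ℤ
sumℤ [] = ℤ.0ℤ
sumℤ (z ∷ zs) = z ℤ.+ sumℤ zs

IsEigenfunction : (n q : ℕ) → ℤ → (Vertex n q → ℤ) → Set
IsEigenfunction n q λ' f =
  (¬ (∀ x → f x ≡ ℤ.0ℤ)) ×
  (∀ x → λ' ℤ.* f x ≡ sumℤ (map (λ y → f x ℤ.- f y) (neighbours x)))

sumℕ : ∀ {m q} → Vertex m q → ℕ
sumℕ {zero} x = 0
sumℕ {suc m} x = toℕ (x Fin.zero) ℕ.+ sumℕ (λ i → x (Fin.suc i))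

InΓ₀ : ∀ {n q} .{{_ : NonZero q}} → Vertex n q → Set
InΓ₀ {q = q} x = sumℕ x % q ≡ 0

-- Type A partition of ℤ_2^{3k}: coordinates 1..k, k+1..2k, 2k+1..3k form the
-- three blocks; x ∈ C₁ iff the block-parity vector is (0,0,0) or (1,1,1).
blockParity : (k : ℕ) → Vertex (k ℕ.+ k ℕ.+ k) 2 → ℕ × ℕ × ℕ
blockParity k x =
  (sumℕ (λ i → x ((i ↑ˡ k) ↑ˡ k)) % 2 ,
   sumℕ (λ i → x ((k ↑ʳ i) ↑ˡ k)) % 2 ,
   sumℕ (λ i → x ((k ℕ.+ k) ↑ʳ i)) % 2)

data InTypeA-C₁ (k : ℕ) (x : Vertex (k ℕ.+ k ℕ.+ k) 2) : Set where
  all0 : blockParity k x ≡ (0 , 0 , 0) → InTypeA-C₁ k x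
  all1 : blockParity k x ≡ (1 , 1 , 1) → InTypeA-C₁ k x

module Submission where

-- Both partitions are equitable, so the Laplacian of f at x only depends on the class of x.
-- For Γ₀: the residue of the coordinate sum runs through all of ℤ_q along every line
-- {x[i := a] | a ∈ ℤ_q}, so each line meets Γ₀ exactly once and f sums to
-- n(q-1) - (q-1)n = 0 on it; the q-1 neighbours of x on the line thus contribute q f(x).
-- For type A: a neighbour flips exactly one block parity. From C₁ all 3k neighbours lie in C₂,
-- and from C₂ exactly the k neighbours in one block lie in C₁, giving 3k·4k and -k·4k.

open import Defs
open import Data.Nat using (ℕ; _≥_; _+_; _*_; _∸_; NonZero)
open import Data.Integer using (ℤ; +_; -_)
open import Data.Product using (_×_; _,_; ∃)
open import Relation.Nullary using (¬_; yes; no; contradiction)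
open import Relation.Binary.PropositionalEquality
  using (_≡_; _≢_; refl; sym; trans; cong; cong₂; subst; module ≡-Reasoning)

open import Data.Nat as ℕ using (zero; suc; _%_; _<_; _≤_; z≤n; s≤s)
import Data.Nat.Properties as ℕ
open import Data.Nat.DivMod using (%-distribˡ-+; m%n%n≡m%n; m%n≤n; m%n<n; n%n≡0; [m+n]%n≡m%n)
open import Data.Nat.Divisibility using (_∣_; ∣⇒≤; ∣m+n∣m⇒∣n; m%n≡0⇒n∣m)
import Data.Integer as ℤ
import Data.Integer.Properties as ℤP
open import Data.Integer.Tactic.RingSolver using (solve-∀)
open import Algebra.Properties.CommutativeMonoid.Sum ℤP.+-0-commutativeMonoid
  using (sum; sum-syntax; sum-cong-≗; sum-remove)
open import Data.Fin as Fin using (Fin; toℕ; _↑ˡ_; _↑ʳ_; opposite; punchIn)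
import Data.Fin.Properties as Fin
open import Data.List using (List; []; _∷_; _++_; map; filter; tabulate; allFin; concatMap)
import Data.List.Properties as List
open import Data.Vec.Functional using (Vector)
open import Data.Vec.Functional.Properties using (updateAt-updates; updateAt-minimal)
open import Data.Sum using (inj₁; inj₂)
open import Function using (_∘_; id)
open import Function.Definitions using (Injective)
open import Relation.Nullary.Decidable using (¬?)

laplacian : ∀ {n q} → (Vertex n q → ℤ) → Vertex n q → ℤ
laplacian f x = sumℤ (map (λ y → f x ℤ.- f y) (neighbours x))

∑-const : ∀ n (c : ℤ) → ∑[ i < n ] c ≡ + n ℤ.* c
∑-const zero    c = refl
∑-const (suc n) c = trans (cong (ℤ._+_ c) (∑-const n c)) (sym (ℤP.suc-* (+ n) c))

∑-sub : ∀ n (c : ℤ) (g : Vector ℤ n) → ∑[ i < n ] (c ℤ.- g i) ≡ + n ℤ.* c ℤ.- sum g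
∑-sub zero    c g = refl
∑-sub (suc n) c g =
  trans (cong (ℤ._+_ (c ℤ.- g Fin.zero)) (∑-sub n c (g ∘ Fin.suc)))
        (shuffle c (g Fin.zero) (+ n) (sum (g ∘ Fin.suc)))
  where
  shuffle : ∀ c g₀ m s → (c ℤ.- g₀) ℤ.+ (m ℤ.* c ℤ.- s) ≡ (ℤ.1ℤ ℤ.+ m) ℤ.* c ℤ.- (g₀ ℤ.+ s)
  shuffle = solve-∀

∑-split : ∀ m n (g : Vector ℤ (m + n)) → sum g ≡ sum (g ∘ (_↑ˡ n)) ℤ.+ sum (g ∘ (m ↑ʳ_))
∑-split zero    n g = sym (ℤP.+-identityˡ _)
∑-split (suc m) n g =
  trans (cong (ℤ._+_ (g Fin.zero)) (∑-split m n (g ∘ Fin.suc))) (sym (ℤP.+-assoc (g Fin.zero) _ _))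

∑-const-except : ∀ {m} (g : Vector ℤ (suc m)) i (b : ℤ) → (∀ j → j ≢ i → g j ≡ b) →
  sum g ≡ g i ℤ.+ + m ℤ.* b
∑-const-except {m} g i b g≡b = trans (sum-remove {i = i} g) (cong (ℤ._+_ (g i)) rest)
  where
  rest : sum (g ∘ punchIn i) ≡ + m ℤ.* b
  rest = trans (sum-cong-≗ (λ j → g≡b (punchIn i j) (Fin.punchInᵢ≢i i j))) (∑-const m b)

sumℤ-++ : ∀ xs ys → sumℤ (xs ++ ys) ≡ sumℤ xs ℤ.+ sumℤ ys
sumℤ-++ []       ys = sym (ℤP.+-identityˡ _)
sumℤ-++ (x ∷ xs) ys = trans (cong (ℤ._+_ x) (sumℤ-++ xs ys)) (sym (ℤP.+-assoc x _ _))

sumℤ-concatMap : ∀ {A : Set} (h : A → List ℤ) xs → sumℤ (concatMap h xs) ≡ sumℤ (map (sumℤ ∘ h) xs)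
sumℤ-concatMap h []       = refl
sumℤ-concatMap h (x ∷ xs) = trans (sumℤ-++ (h x) _) (cong (ℤ._+_ (sumℤ (h x))) (sumℤ-concatMap h xs))

sumℤ-map-tabulate : ∀ {A : Set} n (g : A → ℤ) (h : Fin n → A) → sumℤ (map g (tabulate h)) ≡ sum (g ∘ h)
sumℤ-map-tabulate zero    g h = refl
sumℤ-map-tabulate (suc n) g h = cong (ℤ._+_ (g (h Fin.zero))) (sumℤ-map-tabulate n g (h ∘ Fin.suc))

sumℤ-map-filter-≢ : ∀ {q} (g : Fin q → ℤ) c xs → g c ≡ ℤ.0ℤ →
  sumℤ (map g (filter (λ a → ¬? (a Fin.≟ c)) xs)) ≡ sumℤ (map g xs)
sumℤ-map-filter-≢ g c []       gc≡0 = refl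
sumℤ-map-filter-≢ g c (a ∷ xs) gc≡0 with a Fin.≟ c
... | yes refl = trans (sumℤ-map-filter-≢ g c xs gc≡0)
                       (sym (trans (cong (ℤ._+ sumℤ (map g xs)) gc≡0) (ℤP.+-identityˡ _)))
... | no _     = cong (ℤ._+_ (g a)) (sumℤ-map-filter-≢ g c xs gc≡0)

lineSum : ∀ {n q} → (Vertex n q → ℤ) → Vertex n q → Fin n → ℤ
lineSum {q = q} f x i = sumℤ (map (λ a → f x ℤ.- f (set x i a)) (filter (λ a → ¬? (a Fin.≟ x i)) (allFin q)))

laplacian≡∑lineSum : ∀ {n q} (f : Vertex n q → ℤ) x → laplacian f x ≡ ∑[ i < n ] lineSum f x i
laplacian≡∑lineSum {n} {q} f x = begin
  laplacian f x
    ≡⟨ cong sumℤ (List.map-concatMap d line (allFin n)) ⟩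
  sumℤ (concatMap (map d ∘ line) (allFin n))
    ≡⟨ sumℤ-concatMap (map d ∘ line) (allFin n) ⟩
  sumℤ (map (sumℤ ∘ map d ∘ line) (allFin n))
    ≡⟨ sumℤ-map-tabulate n (sumℤ ∘ map d ∘ line) id ⟩
  ∑[ i < n ] sumℤ (map d (line i))
    ≡⟨ sum-cong-≗ (λ i → cong sumℤ (sym (List.map-∘ (others i)))) ⟩
  ∑[ i < n ] lineSum f x i ∎
  where
  open ≡-Reasoning
  d : Vertex n q → ℤ
  d y = f x ℤ.- f y
  others : Fin n → List (Fin q)
  others i = filter (λ a → ¬? (a Fin.≟ x i)) (allFin q)
  line : Fin n → List (Vertex n q)
  line i = map (set x i) (others i)

lineSum≡q*f-∑ : ∀ {n q} (f : Vertex n q → ℤ) x i → f (set x i (x i)) ≡ f x →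
  lineSum f x i ≡ + q ℤ.* f x ℤ.- ∑[ a < q ] f (set x i a)
lineSum≡q*f-∑ {q = q} f x i fixed = begin
  lineSum f x i
    ≡⟨ sumℤ-map-filter-≢ d (x i) (allFin q) (trans (cong (ℤ._-_ (f x)) fixed) (ℤP.+-inverseʳ (f x))) ⟩
  sumℤ (map d (allFin q))
    ≡⟨ sumℤ-map-tabulate q d id ⟩
  ∑[ a < q ] d a
    ≡⟨ ∑-sub q (f x) (f ∘ set x i) ⟩
  + q ℤ.* f x ℤ.- ∑[ a < q ] f (set x i a) ∎
  where
  open ≡-Reasoning
  d : Fin q → ℤ
  d a = f x ℤ.- f (set x i a)

filter-≢-binary : ∀ (c : Fin 2) → filter (λ a → ¬? (a Fin.≟ c)) (allFin 2) ≡ opposite c ∷ []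
filter-≢-binary Fin.zero            = refl
filter-≢-binary (Fin.suc Fin.zero) = refl

laplacian-binary : ∀ {n} (f : Vertex n 2 → ℤ) x →
  laplacian f x ≡ ∑[ i < n ] (f x ℤ.- f (set x i (opposite (x i))))
laplacian-binary f x = trans (laplacian≡∑lineSum f x) (sum-cong-≗ single)
  where
  single : ∀ i → lineSum f x i ≡ f x ℤ.- f (set x i (opposite (x i)))
  single i = trans (cong (λ as → sumℤ (map (λ a → f x ℤ.- f (set x i a)) as)) (filter-≢-binary (x i)))
                   (ℤP.+-identityʳ _)

nonvanishing : ∀ {A : Set} (f : A → ℤ) x {c} → f x ≡ + c → 1 ≤ c → ¬ (∀ y → f y ≡ ℤ.0ℤ)
nonvanishing f x fx≡c 1≤c f≡0 = ℕ.<⇒≢ 1≤c (sym (ℤP.+-injective (trans (sym fx≡c) (f≡0 x))))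

sumℕ-zeros : ∀ m {q} → sumℕ {m} {suc q} (λ _ → Fin.zero) ≡ 0
sumℕ-zeros zero    = refl
sumℕ-zeros (suc m) = sumℕ-zeros m

sumℕ-cong : ∀ {m q} {x y : Vertex m q} → (∀ i → x i ≡ y i) → sumℕ x ≡ sumℕ y
sumℕ-cong {zero}  x≗y = refl
sumℕ-cong {suc m} x≗y = cong₂ _+_ (cong toℕ (x≗y Fin.zero)) (sumℕ-cong (x≗y ∘ Fin.suc))

sumℕ-set : ∀ {m q} (x : Vertex m q) i a → sumℕ (set x i a) + toℕ (x i) ≡ sumℕ x + toℕ a
sumℕ-set {suc m} x Fin.zero a = swap (toℕ a) (sumℕ (x ∘ Fin.suc)) (toℕ (x Fin.zero))
  where
  swap : ∀ a s b → a + s + b ≡ b + s + a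
  swap a s b = begin
    a + s + b   ≡⟨ ℕ.+-assoc a s b ⟩
    a + (s + b) ≡⟨ ℕ.+-comm a (s + b) ⟩
    s + b + a   ≡⟨ cong (_+ a) (ℕ.+-comm s b) ⟩
    b + s + a   ∎
    where open ≡-Reasoning
sumℕ-set {suc m} x (Fin.suc i) a = begin
  x₀ + sumℕ (set (x ∘ Fin.suc) i a) + toℕ (x (Fin.suc i)) ≡⟨ ℕ.+-assoc x₀ _ _ ⟩
  x₀ + (sumℕ (set (x ∘ Fin.suc) i a) + toℕ (x (Fin.suc i))) ≡⟨ cong (_+_ x₀) (sumℕ-set (x ∘ Fin.suc) i a) ⟩
  x₀ + (sumℕ (x ∘ Fin.suc) + toℕ a) ≡⟨ ℕ.+-assoc x₀ _ _ ⟨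
  x₀ + sumℕ (x ∘ Fin.suc) + toℕ a ∎
  where
  open ≡-Reasoning
  x₀ = toℕ (x Fin.zero)

∣-below⇒≡0 : ∀ {q d} → d < q → q ∣ d → d ≡ 0
∣-below⇒≡0 {d = zero}  _   _   = refl
∣-below⇒≡0 {d = suc d} d<q q∣d = contradiction (∣⇒≤ q∣d) (ℕ.<⇒≱ d<q)

residue-unique-≤ : ∀ {q r a b} → a ≤ b → b < q → q ∣ r + a → q ∣ r + b → a ≡ b
residue-unique-≤ {q} {r} {a} {b} a≤b b<q q∣r+a q∣r+b =
  ℕ.≤-antisym a≤b (ℕ.m∸n≡0⇒m≤n (∣-below⇒≡0 (ℕ.≤-<-trans (ℕ.m∸n≤m b a) b<q) q∣b∸a))
  where
  r+b≡ : r + a + (b ∸ a) ≡ r + b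
  r+b≡ = trans (ℕ.+-assoc r a (b ∸ a)) (cong (_+_ r) (ℕ.m+[n∸m]≡n a≤b))
  q∣b∸a : q ∣ b ∸ a
  q∣b∸a = ∣m+n∣m⇒∣n (subst (q ∣_) (sym r+b≡) q∣r+b) q∣r+a

residue-unique : ∀ {q r a b} → a < q → b < q → q ∣ r + a → q ∣ r + b → a ≡ b
residue-unique {a = a} {b} a<q b<q q∣r+a q∣r+b with ℕ.≤-total a b
... | inj₁ a≤b = residue-unique-≤ a≤b b<q q∣r+a q∣r+b
... | inj₂ b≤a = sym (residue-unique-≤ b≤a a<q q∣r+b q∣r+a)

residue-complement : ∀ q .{{_ : NonZero q}} r → (r + (q ∸ r % q) % q) % q ≡ 0
residue-complement q r = begin
  (r + (q ∸ r % q) % q) % q           ≡⟨ %-distribˡ-+ r _ q ⟩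
  (r % q + (q ∸ r % q) % q % q) % q   ≡⟨ cong (λ u → (r % q + u) % q) (m%n%n≡m%n (q ∸ r % q) q) ⟩
  (r % q + (q ∸ r % q) % q) % q       ≡⟨ cong (λ u → (u + (q ∸ r % q) % q) % q) (m%n%n≡m%n r q) ⟨
  (r % q % q + (q ∸ r % q) % q) % q   ≡⟨ %-distribˡ-+ (r % q) _ q ⟨
  (r % q + (q ∸ r % q)) % q           ≡⟨ cong (_% q) (ℕ.m+[n∸m]≡n (m%n≤n r q)) ⟩
  q % q                               ≡⟨ n%n≡0 q ⟩
  0                                   ∎
  where open ≡-Reasoning

sumℕ-set-% : ∀ {n q} .{{_ : NonZero q}} (x : Vertex n q) i a →
  sumℕ (set x i a) % q ≡ (sumℕ x + (q ∸ toℕ (x i)) + toℕ a) % q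
sumℕ-set-% {q = q} x i a = begin
  t % q                          ≡⟨ [m+n]%n≡m%n t q ⟨
  (t + q) % q                    ≡⟨ cong (λ u → (t + u) % q) (ℕ.m+[n∸m]≡n (ℕ.<⇒≤ (Fin.toℕ<n (x i)))) ⟨
  (t + (toℕ (x i) + c)) % q      ≡⟨ cong (_% q) (ℕ.+-assoc t (toℕ (x i)) c) ⟨
  (t + toℕ (x i) + c) % q        ≡⟨ cong (λ u → (u + c) % q) (sumℕ-set x i a) ⟩
  (sumℕ x + toℕ a + c) % q       ≡⟨ cong (_% q) (ℕ.+-assoc (sumℕ x) (toℕ a) c) ⟩
  (sumℕ x + (toℕ a + c)) % q     ≡⟨ cong (λ u → (sumℕ x + u) % q) (ℕ.+-comm (toℕ a) c) ⟩
  (sumℕ x + (c + toℕ a)) % q     ≡⟨ cong (_% q) (ℕ.+-assoc (sumℕ x) c (toℕ a)) ⟨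
  (sumℕ x + c + toℕ a) % q       ∎
  where
  open ≡-Reasoning
  t = sumℕ (set x i a)
  c = q ∸ toℕ (x i)

Γ₀-line-unique : ∀ {n q} .{{_ : NonZero q}} (x : Vertex n q) i {a b} →
  InΓ₀ (set x i a) → InΓ₀ (set x i b) → a ≡ b
Γ₀-line-unique {q = q} x i {a} {b} a∈Γ₀ b∈Γ₀ =
  Fin.toℕ-injective (residue-unique (Fin.toℕ<n a) (Fin.toℕ<n b) (divides a a∈Γ₀) (divides b b∈Γ₀))
  where
  divides : ∀ c → InΓ₀ (set x i c) → q ∣ sumℕ x + (q ∸ toℕ (x i)) + toℕ c
  divides c c∈Γ₀ = m%n≡0⇒n∣m _ q (trans (sym (sumℕ-set-% x i c)) c∈Γ₀)

Γ₀-line-exists : ∀ {n q} .{{_ : NonZero q}} (x : Vertex n q) i → ∃ λ a → InΓ₀ (set x i a)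
Γ₀-line-exists {q = q} x i = a , trans (sumℕ-set-% x i a) (trans (cong (λ u → (r + u) % q) (Fin.toℕ-fromℕ< _)) (residue-complement q r))
  where
  r = sumℕ x + (q ∸ toℕ (x i))
  a = Fin.fromℕ< (m%n<n (q ∸ r % q) q)

-- q = suc m, so that q ∸ 1 in the hypothesis on C₁ reduces to m.
module Γ₀-partition (n m : ℕ) (f : Vertex n (suc m) → ℤ)
  (f-C₁ : ∀ x → InΓ₀ x → f x ≡ + (n * m))
  (f-C₂ : ∀ x → ¬ InΓ₀ x → f x ≡ - (+ n)) where

  q : ℕ
  q = suc m

  f-residue : ∀ {x y} → sumℕ x % q ≡ sumℕ y % q → f x ≡ f y
  f-residue {x} {y} eq with sumℕ x % q ℕ.≟ 0
  ... | yes x∈Γ₀ = trans (f-C₁ x x∈Γ₀) (sym (f-C₁ y (trans (sym eq) x∈Γ₀)))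
  ... | no  x∉Γ₀ = trans (f-C₂ x x∉Γ₀) (sym (f-C₂ y (x∉Γ₀ ∘ trans eq)))

  ∑-line≡0 : ∀ x i → ∑[ a < q ] f (set x i a) ≡ ℤ.0ℤ
  ∑-line≡0 x i with Γ₀-line-exists x i
  ... | a₀ , a₀∈Γ₀ = begin
    ∑[ a < q ] f (set x i a)                 ≡⟨ ∑-const-except (f ∘ set x i) a₀ (- (+ n)) off-Γ₀ ⟩
    f (set x i a₀) ℤ.+ + m ℤ.* - (+ n)      ≡⟨ cong (ℤ._+ (+ m ℤ.* - (+ n))) (trans (f-C₁ _ a₀∈Γ₀) (ℤP.pos-* n m)) ⟩
    + n ℤ.* + m ℤ.+ + m ℤ.* - (+ n)        ≡⟨ cancel (+ n) (+ m) ⟩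
    ℤ.0ℤ                                     ∎
    where
    open ≡-Reasoning
    off-Γ₀ : ∀ a → a ≢ a₀ → f (set x i a) ≡ - (+ n)
    off-Γ₀ a a≢a₀ = f-C₂ _ (λ a∈Γ₀ → a≢a₀ (Γ₀-line-unique x i a∈Γ₀ a₀∈Γ₀))
    cancel : ∀ N M → N ℤ.* M ℤ.+ M ℤ.* ℤ.- N ≡ ℤ.0ℤ
    cancel = solve-∀

  lineSum≡q*f : ∀ x i → lineSum f x i ≡ + q ℤ.* f x
  lineSum≡q*f x i = begin
    lineSum f x i                                    ≡⟨ lineSum≡q*f-∑ f x i (f-residue (cong (_% q) unchanged)) ⟩
    + q ℤ.* f x ℤ.- ∑[ a < q ] f (set x i a)         ≡⟨ cong (ℤ._-_ (+ q ℤ.* f x)) (∑-line≡0 x i) ⟩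
    + q ℤ.* f x ℤ.- ℤ.0ℤ                             ≡⟨ ℤP.+-identityʳ _ ⟩
    + q ℤ.* f x                                      ∎
    where
    open ≡-Reasoning
    unchanged : sumℕ (set x i (x i)) ≡ sumℕ x
    unchanged = ℕ.+-cancelʳ-≡ (toℕ (x i)) _ _ (sumℕ-set x i (x i))

  eigen : ∀ x → + (q * n) ℤ.* f x ≡ laplacian f x
  eigen x = sym (begin
    laplacian f x                    ≡⟨ laplacian≡∑lineSum f x ⟩
    ∑[ i < n ] lineSum f x i         ≡⟨ sum-cong-≗ (lineSum≡q*f x) ⟩
    ∑[ i < n ] (+ q ℤ.* f x)         ≡⟨ ∑-const n (+ q ℤ.* f x) ⟩
    + n ℤ.* (+ q ℤ.* f x)            ≡⟨ ℤP.*-assoc (+ n) (+ q) (f x) ⟨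
    (+ n ℤ.* + q) ℤ.* f x            ≡⟨ cong (ℤ._* f x) (trans (ℤP.*-comm (+ n) (+ q)) (sym (ℤP.pos-* q n))) ⟩
    + (q * n) ℤ.* f x                ∎)
    where open ≡-Reasoning

Γ₀-eigenfunction : (n q : ℕ) → .{{_ : NonZero q}} → n ≥ 1 → q ≥ 2 → (f : Vertex n q → ℤ) →
  (∀ x → InΓ₀ x → f x ≡ + (n * (q ∸ 1))) →
  (∀ x → ¬ InΓ₀ x → f x ≡ - (+ n)) →
  IsEigenfunction n q (+ (q * n)) f
Γ₀-eigenfunction n (suc m) n≥1 (s≤s m≥1) f f-C₁ f-C₂ =
  nonvanishing f origin (f-C₁ origin (cong (_% suc m) (sumℕ-zeros n))) (ℕ.*-mono-≤ n≥1 m≥1) ,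
  Γ₀-partition.eigen n m f f-C₁ f-C₂
  where
  origin : Vertex n (suc m)
  origin _ = Fin.zero

data Bit : ℕ → Set where
  bit0 : Bit 0
  bit1 : Bit 1

%2-bit : ∀ m → Bit (m % 2)
%2-bit zero          = bit0
%2-bit (suc zero)    = bit1
%2-bit (suc (suc m)) = %2-bit m

%2-suc : ∀ m → suc m % 2 ≡ 1 ∸ m % 2
%2-suc zero          = refl
%2-suc (suc zero)    = refl
%2-suc (suc (suc m)) = %2-suc m

1∸1∸-bit : ∀ {b} → Bit b → 1 ∸ (1 ∸ b) ≡ b
1∸1∸-bit bit0 = refl
1∸1∸-bit bit1 = refl

%2-opposite : ∀ s t (c : Fin 2) → t + toℕ c ≡ s + toℕ (opposite c) → t % 2 ≡ 1 ∸ s % 2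
%2-opposite s t Fin.zero eq =
  trans (cong (_% 2) (trans (sym (ℕ.+-identityʳ t)) (trans eq (ℕ.+-comm s 1)))) (%2-suc s)
%2-opposite s t (Fin.suc Fin.zero) eq = begin
  t % 2              ≡⟨ 1∸1∸-bit (%2-bit t) ⟨
  1 ∸ (1 ∸ t % 2)    ≡⟨ cong (1 ∸_) (%2-suc t) ⟨
  1 ∸ suc t % 2      ≡⟨ cong (λ u → 1 ∸ u % 2) (trans (ℕ.+-comm 1 t) (trans eq (ℕ.+-identityʳ s))) ⟩
  1 ∸ s % 2          ∎
  where open ≡-Reasoning

flipAt : ∀ {n} → Vertex n 2 → Fin n → Vertex n 2
flipAt x i = set x i (opposite (x i))

parity : ∀ {m n} → (Fin m → Fin n) → Vertex n 2 → ℕ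
parity e x = sumℕ (x ∘ e) % 2

parity-bit : ∀ {m n} (e : Fin m → Fin n) x → Bit (parity e x)
parity-bit e x = %2-bit (sumℕ (x ∘ e))

parity-flipAt-inside : ∀ {m n} {e : Fin m → Fin n} → Injective _≡_ _≡_ e → ∀ x j →
  parity e (flipAt x (e j)) ≡ 1 ∸ parity e x
parity-flipAt-inside {e = e} e-inj x j =
  trans (cong (_% 2) (sumℕ-cong restrict))
        (%2-opposite _ _ (x (e j)) (sumℕ-set (x ∘ e) j (opposite (x (e j)))))
  where
  restrict : ∀ j′ → flipAt x (e j) (e j′) ≡ set (x ∘ e) j (opposite (x (e j))) j′
  restrict j′ with j′ Fin.≟ j
  ... | yes refl = trans (updateAt-updates (e j) x) (sym (updateAt-updates j (x ∘ e)))
  ... | no  j′≢j = trans (updateAt-minimal (e j′) (e j) x (j′≢j ∘ e-inj))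
                         (sym (updateAt-minimal j′ j (x ∘ e) j′≢j))

parity-flipAt-outside : ∀ {m n} (e : Fin m → Fin n) x i → (∀ j → e j ≢ i) →
  parity e (flipAt x i) ≡ parity e x
parity-flipAt-outside e x i i∉e =
  cong (_% 2) (sumℕ-cong (λ j → updateAt-minimal (e j) i x (i∉e j)))

↑ˡ≢↑ʳ : ∀ {m n} (i : Fin m) (j : Fin n) → i ↑ˡ n ≢ m ↑ʳ j
↑ˡ≢↑ʳ {m} {n} i j eq
  with trans (sym (Fin.splitAt-↑ˡ m i n)) (trans (cong (Fin.splitAt m) eq) (Fin.splitAt-↑ʳ m n j))
... | ()

typeAValue : ℤ → ℕ × ℕ × ℕ → ℤ
typeAValue K (0 , 0 , 0) = + 3 ℤ.* K
typeAValue K (1 , 1 , 1) = + 3 ℤ.* K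
typeAValue K _           = ℤ.- K

private
  balance-C₁ : ∀ K → (+ 4 ℤ.* K) ℤ.* (+ 3 ℤ.* K) ≡
    K ℤ.* (+ 3 ℤ.* K ℤ.- ℤ.- K) ℤ.+ K ℤ.* (+ 3 ℤ.* K ℤ.- ℤ.- K) ℤ.+ K ℤ.* (+ 3 ℤ.* K ℤ.- ℤ.- K)
  balance-C₁ = solve-∀

  balance-C₂-via₁ : ∀ K → (+ 4 ℤ.* K) ℤ.* ℤ.- K ≡
    K ℤ.* (ℤ.- K ℤ.- + 3 ℤ.* K) ℤ.+ K ℤ.* (ℤ.- K ℤ.- ℤ.- K) ℤ.+ K ℤ.* (ℤ.- K ℤ.- ℤ.- K)
  balance-C₂-via₁ = solve-∀

  balance-C₂-via₂ : ∀ K → (+ 4 ℤ.* K) ℤ.* ℤ.- K ≡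
    K ℤ.* (ℤ.- K ℤ.- ℤ.- K) ℤ.+ K ℤ.* (ℤ.- K ℤ.- + 3 ℤ.* K) ℤ.+ K ℤ.* (ℤ.- K ℤ.- ℤ.- K)
  balance-C₂-via₂ = solve-∀

  balance-C₂-via₃ : ∀ K → (+ 4 ℤ.* K) ℤ.* ℤ.- K ≡
    K ℤ.* (ℤ.- K ℤ.- ℤ.- K) ℤ.+ K ℤ.* (ℤ.- K ℤ.- ℤ.- K) ℤ.+ K ℤ.* (ℤ.- K ℤ.- + 3 ℤ.* K)
  balance-C₂-via₃ = solve-∀

-- From C₁ every flip leads into C₂; from C₂ exactly one of the three flips leads into C₁.
typeAValue-balance : ∀ K {p₁ p₂ p₃} → Bit p₁ → Bit p₂ → Bit p₃ →
  let v = typeAValue K in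
  (+ 4 ℤ.* K) ℤ.* v (p₁ , p₂ , p₃) ≡
    K ℤ.* (v (p₁ , p₂ , p₃) ℤ.- v (1 ∸ p₁ , p₂ , p₃)) ℤ.+
    K ℤ.* (v (p₁ , p₂ , p₃) ℤ.- v (p₁ , 1 ∸ p₂ , p₃)) ℤ.+
    K ℤ.* (v (p₁ , p₂ , p₃) ℤ.- v (p₁ , p₂ , 1 ∸ p₃))
typeAValue-balance K bit0 bit0 bit0 = balance-C₁ K
typeAValue-balance K bit1 bit1 bit1 = balance-C₁ K
typeAValue-balance K bit1 bit0 bit0 = balance-C₂-via₁ K
typeAValue-balance K bit0 bit1 bit1 = balance-C₂-via₁ K
typeAValue-balance K bit0 bit1 bit0 = balance-C₂-via₂ K
typeAValue-balance K bit1 bit0 bit1 = balance-C₂-via₂ K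
typeAValue-balance K bit0 bit0 bit1 = balance-C₂-via₃ K
typeAValue-balance K bit1 bit1 bit0 = balance-C₂-via₃ K

module TypeA-partition (k : ℕ) (f : Vertex (k + k + k) 2 → ℤ)
  (f-C₁ : ∀ x → InTypeA-C₁ k x → f x ≡ + (3 * k))
  (f-C₂ : ∀ x → ¬ InTypeA-C₁ k x → f x ≡ - (+ k)) where

  e₁ e₂ e₃ : Fin k → Fin (k + k + k)
  e₁ j = (j ↑ˡ k) ↑ˡ k
  e₂ j = (k ↑ʳ j) ↑ˡ k
  e₃ j = (k + k) ↑ʳ j

  e₁-injective : Injective _≡_ _≡_ e₁
  e₁-injective = Fin.↑ˡ-injective k _ _ ∘ Fin.↑ˡ-injective k _ _
  e₂-injective : Injective _≡_ _≡_ e₂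
  e₂-injective = Fin.↑ʳ-injective k _ _ ∘ Fin.↑ˡ-injective k _ _
  e₃-injective : Injective _≡_ _≡_ e₃
  e₃-injective = Fin.↑ʳ-injective (k + k) _ _

  e₁≢e₂ : ∀ a b → e₁ a ≢ e₂ b
  e₁≢e₂ a b = ↑ˡ≢↑ʳ a b ∘ Fin.↑ˡ-injective k _ _
  e₁≢e₃ : ∀ a b → e₁ a ≢ e₃ b
  e₁≢e₃ a b = ↑ˡ≢↑ʳ (a ↑ˡ k) b
  e₂≢e₃ : ∀ a b → e₂ a ≢ e₃ b
  e₂≢e₃ a b = ↑ˡ≢↑ʳ (k ↑ʳ a) b

  parities : Vertex (k + k + k) 2 → ℕ × ℕ × ℕ
  parities x = parity e₁ x , parity e₂ x , parity e₃ x

  f≡typeAValue : ∀ x → f x ≡ typeAValue (+ k) (parities x)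
  f≡typeAValue x = classify (parity-bit e₁ x) (parity-bit e₂ x) (parity-bit e₃ x) refl
    where
    inC₁ : InTypeA-C₁ k x → f x ≡ + 3 ℤ.* + k
    inC₁ x∈C₁ = trans (f-C₁ x x∈C₁) (ℤP.pos-* 3 k)
    inC₂ : ∀ {t} → blockParity k x ≡ t → t ≢ (0 , 0 , 0) → t ≢ (1 , 1 , 1) → f x ≡ ℤ.- + k
    inC₂ eq t≢000 t≢111 = f-C₂ x λ
      { (all0 x∈C₁) → t≢000 (trans (sym eq) x∈C₁)
      ; (all1 x∈C₁) → t≢111 (trans (sym eq) x∈C₁) }
    classify : ∀ {p₁ p₂ p₃} → Bit p₁ → Bit p₂ → Bit p₃ → blockParity k x ≡ (p₁ , p₂ , p₃) →
      f x ≡ typeAValue (+ k) (p₁ , p₂ , p₃)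
    classify bit0 bit0 bit0 eq = inC₁ (all0 eq)
    classify bit1 bit1 bit1 eq = inC₁ (all1 eq)
    classify bit0 bit0 bit1 eq = inC₂ eq (λ ()) (λ ())
    classify bit0 bit1 bit0 eq = inC₂ eq (λ ()) (λ ())
    classify bit0 bit1 bit1 eq = inC₂ eq (λ ()) (λ ())
    classify bit1 bit0 bit0 eq = inC₂ eq (λ ()) (λ ())
    classify bit1 bit0 bit1 eq = inC₂ eq (λ ()) (λ ())
    classify bit1 bit1 bit0 eq = inC₂ eq (λ ()) (λ ())

  parities-flipAt-e₁ : ∀ x j → parities (flipAt x (e₁ j)) ≡ (1 ∸ parity e₁ x , parity e₂ x , parity e₃ x)
  parities-flipAt-e₁ x j = cong₂ _,_ (parity-flipAt-inside e₁-injective x j)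
    (cong₂ _,_ (parity-flipAt-outside e₂ x (e₁ j) (λ b → e₁≢e₂ j b ∘ sym))
               (parity-flipAt-outside e₃ x (e₁ j) (λ b → e₁≢e₃ j b ∘ sym)))

  parities-flipAt-e₂ : ∀ x j → parities (flipAt x (e₂ j)) ≡ (parity e₁ x , 1 ∸ parity e₂ x , parity e₃ x)
  parities-flipAt-e₂ x j = cong₂ _,_ (parity-flipAt-outside e₁ x (e₂ j) (λ a → e₁≢e₂ a j))
    (cong₂ _,_ (parity-flipAt-inside e₂-injective x j)
               (parity-flipAt-outside e₃ x (e₂ j) (λ b → e₂≢e₃ j b ∘ sym)))

  parities-flipAt-e₃ : ∀ x j → parities (flipAt x (e₃ j)) ≡ (parity e₁ x , parity e₂ x , 1 ∸ parity e₃ x)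
  parities-flipAt-e₃ x j = cong₂ _,_ (parity-flipAt-outside e₁ x (e₃ j) (λ a → e₁≢e₃ a j))
    (cong₂ _,_ (parity-flipAt-outside e₂ x (e₃ j) (λ a → e₂≢e₃ a j))
               (parity-flipAt-inside e₃-injective x j))

  ∑-flips-in-block : ∀ x (e : Fin k → Fin (k + k + k)) {t : ℕ × ℕ × ℕ} → (∀ j → parities (flipAt x (e j)) ≡ t) →
    ∑[ j < k ] (f x ℤ.- f (flipAt x (e j))) ≡ + k ℤ.* (typeAValue (+ k) (parities x) ℤ.- typeAValue (+ k) t)
  ∑-flips-in-block x e {t} flip≡t = trans (sum-cong-≗ difference) (∑-const k _)
    where
    difference : ∀ j → f x ℤ.- f (flipAt x (e j)) ≡ typeAValue (+ k) (parities x) ℤ.- typeAValue (+ k) t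
    difference j = cong₂ ℤ._-_ (f≡typeAValue x) (trans (f≡typeAValue _) (cong (typeAValue (+ k)) (flip≡t j)))

  eigen : ∀ x → + (4 * k) ℤ.* f x ≡ laplacian f x
  eigen x = begin
    + (4 * k) ℤ.* f x
      ≡⟨ cong₂ ℤ._*_ (ℤP.pos-* 4 k) (f≡typeAValue x) ⟩
    (+ 4 ℤ.* + k) ℤ.* typeAValue (+ k) (parities x)
      ≡⟨ typeAValue-balance (+ k) (parity-bit e₁ x) (parity-bit e₂ x) (parity-bit e₃ x) ⟩
    _ ≡⟨ cong₂ ℤ._+_ (cong₂ ℤ._+_ (∑-flips-in-block x e₁ (parities-flipAt-e₁ x))
                                  (∑-flips-in-block x e₂ (parities-flipAt-e₂ x)))
                     (∑-flips-in-block x e₃ (parities-flipAt-e₃ x)) ⟨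
    ∑[ j < k ] g (e₁ j) ℤ.+ ∑[ j < k ] g (e₂ j) ℤ.+ ∑[ j < k ] g (e₃ j)
      ≡⟨ cong (ℤ._+ ∑[ j < k ] g (e₃ j)) (∑-split k k (g ∘ (_↑ˡ k))) ⟨
    ∑[ i < k + k ] g (i ↑ˡ k) ℤ.+ ∑[ j < k ] g (e₃ j)
      ≡⟨ ∑-split (k + k) k g ⟨
    ∑[ i < k + k + k ] g i
      ≡⟨ laplacian-binary f x ⟨
    laplacian f x ∎
    where
    open ≡-Reasoning
    g : Fin (k + k + k) → ℤ
    g i = f x ℤ.- f (flipAt x i)

typeA-eigenfunction : (k : ℕ) → k ≥ 1 → (f : Vertex (k + k + k) 2 → ℤ) →
  (∀ x → InTypeA-C₁ k x → f x ≡ + (3 * k)) →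
  (∀ x → ¬ InTypeA-C₁ k x → f x ≡ - (+ k)) →
  IsEigenfunction (k + k + k) 2 (+ (4 * k)) f
typeA-eigenfunction k k≥1 f f-C₁ f-C₂ =
  nonvanishing f origin (f-C₁ origin (all0 (cong (λ s → s % 2 , s % 2 , s % 2) (sumℕ-zeros k))))
               (ℕ.*-mono-≤ {1} {3} (s≤s z≤n) k≥1) ,
  TypeA-partition.eigen k f f-C₁ f-C₂
  where
  origin : Vertex (k + k + k) 2
  origin _ = Fin.zero

lemma12 : ((k : ℕ) → k ≥ 1 → (f : Vertex (k + k + k) 2 → ℤ) →
    (∀ x → InTypeA-C₁ k x → f x ≡ + (3 * k)) →
    (∀ x → ¬ InTypeA-C₁ k x → f x ≡ - (+ k)) →
    IsEigenfunction (k + k + k) 2 (+ (4 * k)) f)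
    ×
    ((n q : ℕ) → .{{_ : NonZero q}} → n ≥ 1 → q ≥ 2 → (f : Vertex n q → ℤ) →
    (∀ x → InΓ₀ x → f x ≡ + (n * (q ∸ 1))) →
    (∀ x → ¬ InΓ₀ x → f x ≡ - (+ n)) →
    IsEigenfunction n q (+ (q * n)) f)
lemma12 = typeA-eigenfunction , Γ₀-eigenfunction
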